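{- For an integer $m\ge 3$, let $G_{4m+2}$ be the graph with vertex set $\{x,y,z\}\cup\{y_1,\dots,y_{2m-1}\}\cup\{z_1,\dots,z_{2m}\}$ and edge set $\{yz\}\cup\{xy_i,\ y_iy : 1\le i\le 2m-1\}\cup\{xz_i,\ z_iz: 1\le i\le 2m\}\cup\{y_iy_{1+((i+m-2)\bmod (2m-1))}: 1\le i\le 2m-1\}\cup\{z_iz_j: 1\le i<j\le 2m,\ j\ne i+m\}\cup\{y_iz_j: 1\le i\le 2m-1,\ 1\le j\le 2m,\ j\ne i,\ j\ne i+1\}$. Then $\gamma_t(G_{4m+2})=3$.
   Context: A set $S\subseteq V(G)$ is a total dominating set of a graph $G$ if every vertex of $G$ (including those in $S$) is adjacent to some vertex of $S$; $\gamma_t(G)$ is the minimum cardinality of a total dominating set. -}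

module Defs where

open import Data.Nat using (ℕ; zero; suc; _+_; _*_; _∸_; _≤_; _<_)
open import Data.Nat.DivMod using (_%_)
open import Data.Fin using (Fin; toℕ)
open import Data.List using (List; length)
open import Data.List.Membership.Propositional using (_∈_)
open import Data.List.Relation.Unary.Unique.Propositional using (Unique)
open import Data.Product using (Σ; ∃; _×_)
open import Data.Sum using (_⊎_)
open import Relation.Binary.PropositionalEquality using (_≡_; _≢_)

IsTotalDominating : (V : Set) → (V → V → Set) → List V → Set
IsTotalDominating V Adj S = (v : V) → ∃ λ u → (u ∈ S) × Adj v u

TotalDominationNumberIs : (V : Set) → (V → V → Set) → ℕ → Set
TotalDominationNumberIs V Adj k =
  (Σ (List V) λ S → Unique S × IsTotalDominating V Adj S × length S ≡ k)
  × ((S : List V) → Unique S → IsTotalDominating V Adj S → k ≤ length S)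

-- The graph G_{4m+2}.
-- y_i  (1 ≤ i ≤ 2m-1) is  vY a  with  a : Fin (2m-1), i = 1 + toℕ a;
-- z_j  (1 ≤ j ≤ 2m)   is  vZ b  with  b : Fin (2m),   j = 1 + toℕ b.

data Vtx (m : ℕ) : Set where
  vx vy vz : Vtx m
  vY : Fin (2 * m ∸ 1) → Vtx m
  vZ : Fin (2 * m) → Vtx m

idx : ∀ {n} → Fin n → ℕ
idx a = suc (toℕ a)

-- Note: 2m-1 is written suc (2 * m ∸ 2) as modulus (equal for m ≥ 1), so
-- that Agda's _%_ sees a nonzero divisor.
data Edge (m : ℕ) : Vtx m → Vtx m → Set where
  e-yz : Edge m vy vz
  e-xY : (a : Fin (2 * m ∸ 1)) → Edge m vx (vY a)
  e-Yy : (a : Fin (2 * m ∸ 1)) → Edge m (vY a) vy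
  e-xZ : (b : Fin (2 * m)) → Edge m vx (vZ b)
  e-Zz : (b : Fin (2 * m)) → Edge m (vZ b) vz
  e-YY : (a a' : Fin (2 * m ∸ 1)) →
         idx a' ≡ 1 + ((idx a + m ∸ 2) % suc (2 * m ∸ 2)) →
         Edge m (vY a) (vY a')
  e-ZZ : (b b' : Fin (2 * m)) → idx b < idx b' → idx b' ≢ idx b + m →
         Edge m (vZ b) (vZ b')
  e-YZ : (a : Fin (2 * m ∸ 1)) (b : Fin (2 * m)) →
         idx b ≢ idx a → idx b ≢ idx a + 1 →
         Edge m (vY a) (vZ b)

Adj : (m : ℕ) → Vtx m → Vtx m → Set
Adj m u v = Edge m u v ⊎ Edge m v u

-- {x, z, z_1} is a total dominating set. No set of at most two vertices is one, because any
-- two vertices u, v have a common non-neighbour: one of x, y, z for most pairs, and one of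
-- z_i, z_(i+1), y_(j-1), y_j for the pair y_i, z_j. The latter is index arithmetic, resting on
-- two facts: y_i y_k is an edge iff |i - k| ∈ {m - 1, m}, and z_k z_l is not an edge when
-- |k - l| = m.
module Submission where

open import Defs
open import Data.Empty using (⊥-elim)
open import Data.Fin using (Fin; toℕ; fromℕ<; inject₁) renaming (zero to fzero)
open import Data.Fin.Properties using (toℕ<n; toℕ-fromℕ<; toℕ-inject₁)
open import Data.List using ([]; _∷_; length)
open import Data.List.Relation.Unary.All using ([]; _∷_)
open import Data.List.Relation.Unary.AllPairs using ([]; _∷_)
open import Data.List.Relation.Unary.Any using (here; there)
open import Data.List.Relation.Unary.Unique.Propositional using (Unique)
open import Data.Nat using (ℕ; zero; suc; _+_; _*_; _∸_; _≤_; _<_; z≤n; s≤s; s≤s⁻¹; _≟_; _≤?_)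
open import Data.Nat.DivMod using (_%_; m≤n⇒m%n≡m; [m+n]%n≡m%n)
open import Data.Nat.Properties
open import Data.Nat.Tactic.RingSolver using (solve-∀)
open import Data.Product using (∃; _×_; _,_)
open import Data.Sum using (_⊎_; inj₁; inj₂; [_,_]; map; swap)
open import Function using (_∘_)
open import Relation.Binary.PropositionalEquality
  using (_≡_; _≢_; refl; sym; trans; cong; subst; module ≡-Reasoning)
open import Relation.Nullary using (¬_; Dec; yes; no)
open import Relation.Nullary.Decidable using (_⊎-dec_)

module _ {V : Set} (_~_ : V → V → Set) where

  CommonNonNeighbour : V → V → Set
  CommonNonNeighbour u v = ∃ λ w → ¬ w ~ u × ¬ w ~ v

  commonNonNeighbour-sym : ∀ {u v} → CommonNonNeighbour u v → CommonNonNeighbour v u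
  commonNonNeighbour-sym (w , w≁u , w≁v) = w , w≁v , w≁u

  3≤length-totalDominating : V → (∀ u v → CommonNonNeighbour u v) →
                             ∀ S → IsTotalDominating V _~_ S → 3 ≤ length S
  3≤length-totalDominating v _ [] dom with dom v
  ... | _ , () , _
  3≤length-totalDominating _ common (u ∷ []) dom with common u u
  ... | w , w≁u , _ with dom w
  ... | _ , here refl , w~u = ⊥-elim (w≁u w~u)
  ... | _ , there () , _
  3≤length-totalDominating _ common (u ∷ v ∷ []) dom with common u v
  ... | w , w≁u , w≁v with dom w
  ... | _ , here refl , w~u = ⊥-elim (w≁u w~u)
  ... | _ , there (here refl) , w~v = ⊥-elim (w≁v w~v)
  ... | _ , there (there ()) , _
  3≤length-totalDominating _ _ (_ ∷ _ ∷ _ ∷ _) _ = s≤s (s≤s (s≤s z≤n))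

Apart : ℕ → ℕ → ℕ → Set
Apart d a c = a + d ≡ c ⊎ c + d ≡ a

apart? : ∀ d a c → Dec (Apart d a c)
apart? d a c = (a + d ≟ c) ⊎-dec (c + d ≟ a)

apart-suc : ∀ {d a c} → Apart d a c → Apart d (suc a) (suc c)
apart-suc (inj₁ a+d≡c) = inj₁ (cong suc a+d≡c)
apart-suc (inj₂ c+d≡a) = inj₂ (cong suc c+d≡a)

rotate-apart : ∀ n a → a ≤ n + n →
               let r = (a + n) % suc (n + n) in Apart n a r ⊎ Apart (suc n) a r
rotate-apart n a a≤2n with a ≤? n
... | yes a≤n = inj₁ (inj₁ (sym (m≤n⇒m%n≡m (+-monoˡ-≤ n a≤n))))
... | no a≰n with m≤n⇒∃[o]m+o≡n (≰⇒> a≰n)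
... | d , refl = inj₂ (inj₂ (trans (cong (_+ suc n) r≡d) (+-comm d (suc n))))
  where
  open ≡-Reasoning
  wrap : ∀ n d → suc n + d + n ≡ d + suc (n + n)
  wrap = solve-∀
  r≡d : (suc n + d + n) % suc (n + n) ≡ d
  r≡d = begin
    (suc n + d + n) % suc (n + n)   ≡⟨ cong (_% suc (n + n)) (wrap n d) ⟩
    (d + suc (n + n)) % suc (n + n) ≡⟨ [m+n]%n≡m%n d (suc (n + n)) ⟩
    d % suc (n + n)                 ≡⟨ m≤n⇒m%n≡m (m+n≤o⇒n≤o (suc n) a≤2n) ⟩
    d                               ∎

n+n≢1 : ∀ n → n + n ≢ 1
n+n≢1 (suc n) eq with trans (sym (+-suc n n)) (suc-injective eq)
... | ()

-- With m = n + 1 and 0-based indices: a common non-neighbour of y_a and z_b is either z_d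
-- with d ∈ {a, a + 1} opposite to z_b, or y_c with b ∈ {c, c + 1} not adjacent to y_a.
data YZWitness (n a b : ℕ) : Set where
  viaZ : ∀ d → d ≤ suc (n + n) → d ≡ a ⊎ d ≡ suc a → Apart (suc n) d b → YZWitness n a b
  viaY : ∀ c → c ≤ n + n → b ≡ c ⊎ b ≡ suc c →
         ¬ Apart n a c → ¬ Apart (suc n) a c → YZWitness n a b

module _ {n a : ℕ} (0<n : 0 < n) (a≤2n : a ≤ n + n) where

  ¬apart-pred : ∀ {c} → suc c ≡ suc (n + n) ⊎ Apart n a (suc c) →
                ¬ Apart (suc n) a (suc c) → ¬ Apart n a c
  ¬apart-pred _ ¬a↔1+c (inj₁ a+n≡c) = ¬a↔1+c (inj₁ (trans (+-suc a n) (cong suc a+n≡c)))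
  ¬apart-pred (inj₁ refl) _ (inj₂ refl) = <⇒≱ (m<m+n (n + n) 0<n) a≤2n
  ¬apart-pred {c} (inj₂ (inj₁ a+n≡1+c)) _ (inj₂ refl) =
    n+n≢1 n (+-cancelˡ-≡ c (n + n) 1 (trans (sym (+-assoc c n n)) (trans a+n≡1+c (+-comm 1 c))))
  ¬apart-pred (inj₂ (inj₂ 1+c+n≡a)) _ (inj₂ refl) = 1+n≢n 1+c+n≡a

  yzWitness-pred : ∀ {b} → b ≤ suc (n + n) → b ≡ suc (n + n) ⊎ Apart n a b →
                   ¬ Apart (suc n) a b → ¬ Apart (suc n) (suc a) b → YZWitness n a b
  yzWitness-pred {zero} _ (inj₂ (inj₁ a+n≡0)) _ _ = ⊥-elim (<⇒≢ 0<n (sym (m+n≡0⇒n≡0 a a+n≡0)))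
  yzWitness-pred {zero} _ (inj₂ (inj₂ n≡a)) _ ¬1+a↔0 = ⊥-elim (¬1+a↔0 (inj₂ (cong suc n≡a)))
  yzWitness-pred {suc c} 1+c≤ blocked ¬a↔1+c ¬1+a↔1+c =
    viaY c (s≤s⁻¹ 1+c≤) (inj₂ refl) (¬apart-pred blocked ¬a↔1+c) (¬1+a↔1+c ∘ apart-suc)

  yzWitness : ∀ {b} → b ≤ suc (n + n) → YZWitness n a b
  yzWitness {b} b≤ with apart? (suc n) a b | apart? (suc n) (suc a) b
  ... | yes a↔b | _ = viaZ a (m≤n⇒m≤1+n a≤2n) (inj₁ refl) a↔b
  ... | no _ | yes 1+a↔b = viaZ (suc a) (s≤s a≤2n) (inj₂ refl) 1+a↔b
  ... | no ¬a↔b | no ¬1+a↔b with m≤n⇒m<n∨m≡n b≤ | apart? n a b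
  ...   | inj₁ b<1+2n | no ¬a-b = viaY b (s≤s⁻¹ b<1+2n) (inj₁ refl) ¬a-b ¬a↔b
  ...   | inj₁ _      | yes a-b = yzWitness-pred b≤ (inj₂ a-b) ¬a↔b ¬1+a↔b
  ...   | inj₂ b≡1+2n | _       = yzWitness-pred b≤ (inj₁ b≡1+2n) ¬a↔b ¬1+a↔b

-- The graph G_(4m+2) for m = n + 1; toℕ gives the 0-based index of y_i and z_j.
module _ (n : ℕ) where

  private
    _~_ : Vtx (suc n) → Vtx (suc n) → Set
    _~_ = Adj (suc n)

  2*[1+n]∸1≡1+n+n : 2 * suc n ∸ 1 ≡ suc (n + n)
  2*[1+n]∸1≡1+n+n = trans (+-suc n (n + 0)) (cong (suc ∘ (n +_)) (+-identityʳ n))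

  Y-bound : (a : Fin (2 * suc n ∸ 1)) → toℕ a ≤ n + n
  Y-bound a = s≤s⁻¹ (subst (toℕ a <_) 2*[1+n]∸1≡1+n+n (toℕ<n a))

  Z-bound : (b : Fin (2 * suc n)) → toℕ b ≤ suc (n + n)
  Z-bound b = s≤s⁻¹ (subst (toℕ b <_) (cong suc 2*[1+n]∸1≡1+n+n) (toℕ<n b))

  Y-at : ∀ c → c ≤ n + n → ∃ λ (a : Fin (2 * suc n ∸ 1)) → toℕ a ≡ c
  Y-at c c≤ = fromℕ< c< , toℕ-fromℕ< c<
    where c< = subst (c <_) (sym 2*[1+n]∸1≡1+n+n) (s≤s c≤)

  Z-at : ∀ c → c ≤ suc (n + n) → ∃ λ (b : Fin (2 * suc n)) → toℕ b ≡ c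
  Z-at c c≤ = fromℕ< c< , toℕ-fromℕ< c<
    where c< = subst (c <_) (sym (cong suc 2*[1+n]∸1≡1+n+n)) (s≤s c≤)

  Y-successor : ∀ a → (suc a + suc n ∸ 2) % suc (2 * suc n ∸ 2) ≡ (a + n) % suc (n + n)
  Y-successor a rewrite +-suc a n | +-identityʳ n | +-suc n n = refl

  Y-successor-apart : (a c : Fin (2 * suc n ∸ 1)) →
                      idx c ≡ 1 + ((idx a + suc n ∸ 2) % suc (2 * suc n ∸ 2)) →
                      Apart n (toℕ a) (toℕ c) ⊎ Apart (suc n) (toℕ a) (toℕ c)
  Y-successor-apart a c eq =
    subst (λ r → Apart n (toℕ a) r ⊎ Apart (suc n) (toℕ a) r)
          (sym (trans (suc-injective eq) (Y-successor (toℕ a))))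
          (rotate-apart n (toℕ a) (Y-bound a))

  Y~Y⇒apart : ∀ {a c} → vY a ~ vY c →
              Apart n (toℕ a) (toℕ c) ⊎ Apart (suc n) (toℕ a) (toℕ c)
  Y~Y⇒apart (inj₁ (e-YY a c eq)) = Y-successor-apart a c eq
  Y~Y⇒apart (inj₂ (e-YY c a eq)) = map swap swap (Y-successor-apart c a eq)

  Y≁Y : ∀ {a c} → ¬ Apart n (toℕ a) (toℕ c) → ¬ Apart (suc n) (toℕ a) (toℕ c) → ¬ vY a ~ vY c
  Y≁Y ¬a-c ¬a↔c = [ ¬a-c , ¬a↔c ] ∘ Y~Y⇒apart

  Y≁Z : ∀ {a b} → toℕ b ≡ toℕ a ⊎ toℕ b ≡ suc (toℕ a) → ¬ vY a ~ vZ b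
  Y≁Z (inj₁ b≡a) (inj₁ (e-YZ _ _ b≢a _)) = b≢a (cong suc b≡a)
  Y≁Z (inj₂ b≡1+a) (inj₁ (e-YZ _ _ _ b≢a+1)) = b≢a+1 (cong suc (trans b≡1+a (+-comm 1 _)))
  Y≁Z _ (inj₂ ())

  Z-antipodes-no-edge : ∀ {b c} → Apart (suc n) (toℕ b) (toℕ c) → ¬ Edge (suc n) (vZ b) (vZ c)
  Z-antipodes-no-edge (inj₁ b+m≡c) (e-ZZ _ _ _ c≢b+m) = c≢b+m (cong suc (sym b+m≡c))
  Z-antipodes-no-edge {c = c} (inj₂ c+m≡b) (e-ZZ _ _ b<c _) =
    <⇒≱ b<c (s≤s (subst (toℕ c ≤_) c+m≡b (m≤m+n (toℕ c) (suc n))))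

  Z≁Z : ∀ {b c} → Apart (suc n) (toℕ b) (toℕ c) → ¬ vZ b ~ vZ c
  Z≁Z b↔c = [ Z-antipodes-no-edge b↔c , Z-antipodes-no-edge (swap b↔c) ]

  ≁-sym : ∀ {u v} → ¬ u ~ v → ¬ v ~ u
  ≁-sym u≁v = u≁v ∘ swap

  x≁x : ¬ vx ~ vx
  x≁x = [ (λ ()) , (λ ()) ]
  x≁y : ¬ vx ~ vy
  x≁y = [ (λ ()) , (λ ()) ]
  x≁z : ¬ vx ~ vz
  x≁z = [ (λ ()) , (λ ()) ]
  y≁x : ¬ vy ~ vx
  y≁x = [ (λ ()) , (λ ()) ]
  y≁y : ¬ vy ~ vy
  y≁y = [ (λ ()) , (λ ()) ]
  y≁Z : ∀ {b} → ¬ vy ~ vZ b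
  y≁Z = [ (λ ()) , (λ ()) ]
  z≁x : ¬ vz ~ vx
  z≁x = [ (λ ()) , (λ ()) ]
  z≁z : ¬ vz ~ vz
  z≁z = [ (λ ()) , (λ ()) ]
  z≁Y : ∀ {a} → ¬ vz ~ vY a
  z≁Y = [ (λ ()) , (λ ()) ]

  module _ (0<n : 0 < n) where

    YZ-commonNonNeighbour : ∀ a b → CommonNonNeighbour _~_ (vY a) (vZ b)
    YZ-commonNonNeighbour a b with yzWitness 0<n (Y-bound a) (Z-bound b)
    ... | viaZ d d≤ d≡a∨1+a d↔b with Z-at d d≤
    ...   | d , refl = vZ d , ≁-sym (Y≁Z d≡a∨1+a) , Z≁Z d↔b
    YZ-commonNonNeighbour a b | viaY c c≤ b≡c∨1+c ¬a-c ¬a↔c with Y-at c c≤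
    ...   | c , refl = vY c , Y≁Y (¬a-c ∘ swap) (¬a↔c ∘ swap) , Y≁Z b≡c∨1+c

    commonNonNeighbour : ∀ u v → CommonNonNeighbour _~_ u v
    commonNonNeighbour vx vx = vx , x≁x , x≁x
    commonNonNeighbour vx vy = vx , x≁x , x≁y
    commonNonNeighbour vx vz = vx , x≁x , x≁z
    commonNonNeighbour vx (vY a) = vz , z≁x , z≁Y
    commonNonNeighbour vx (vZ b) = vy , y≁x , y≁Z
    commonNonNeighbour vy vy = vx , x≁y , x≁y
    commonNonNeighbour vy vz = vx , x≁y , x≁z
    commonNonNeighbour vy (vY a) = vZ (inject₁ a) , ≁-sym y≁Z , ≁-sym (Y≁Z (inj₁ (toℕ-inject₁ a)))
    commonNonNeighbour vy (vZ b) = vy , y≁y , y≁Z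
    commonNonNeighbour vz vz = vx , x≁z , x≁z
    commonNonNeighbour vz (vY a) = vz , z≁z , z≁Y
    commonNonNeighbour vz (vZ b) with m≤n⇒m<n∨m≡n (Z-bound b)
    ... | inj₁ b<1+2n with Y-at (toℕ b) (s≤s⁻¹ b<1+2n)
    ...   | c , c≡b = vY c , ≁-sym z≁Y , Y≁Z (inj₁ (sym c≡b))
    commonNonNeighbour vz (vZ b) | inj₂ b≡1+2n with Y-at (n + n) ≤-refl
    ...   | c , c≡2n = vY c , ≁-sym z≁Y , Y≁Z (inj₂ (trans b≡1+2n (cong suc (sym c≡2n))))
    commonNonNeighbour (vY a) (vY c) = vz , z≁Y , z≁Y
    commonNonNeighbour (vY a) (vZ b) = YZ-commonNonNeighbour a b
    commonNonNeighbour (vZ b) (vZ c) = vy , y≁Z , y≁Z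
    commonNonNeighbour vy vx = commonNonNeighbour-sym _~_ (commonNonNeighbour vx vy)
    commonNonNeighbour vz vx = commonNonNeighbour-sym _~_ (commonNonNeighbour vx vz)
    commonNonNeighbour (vY a) vx = commonNonNeighbour-sym _~_ (commonNonNeighbour vx (vY a))
    commonNonNeighbour (vZ b) vx = commonNonNeighbour-sym _~_ (commonNonNeighbour vx (vZ b))
    commonNonNeighbour vz vy = commonNonNeighbour-sym _~_ (commonNonNeighbour vy vz)
    commonNonNeighbour (vY a) vy = commonNonNeighbour-sym _~_ (commonNonNeighbour vy (vY a))
    commonNonNeighbour (vZ b) vy = commonNonNeighbour-sym _~_ (commonNonNeighbour vy (vZ b))
    commonNonNeighbour (vY a) vz = commonNonNeighbour-sym _~_ (commonNonNeighbour vz (vY a))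
    commonNonNeighbour (vZ b) vz = commonNonNeighbour-sym _~_ (commonNonNeighbour vz (vZ b))
    commonNonNeighbour (vZ b) (vY a) = commonNonNeighbour-sym _~_ (commonNonNeighbour (vY a) (vZ b))

  dominating : IsTotalDominating (Vtx (suc n)) _~_ (vx ∷ vz ∷ vZ fzero ∷ [])
  dominating vx     = vZ fzero , there (there (here refl)) , inj₁ (e-xZ fzero)
  dominating vy     = vz , there (here refl) , inj₁ e-yz
  dominating vz     = vZ fzero , there (there (here refl)) , inj₂ (e-Zz fzero)
  dominating (vY a) = vx , here refl , inj₂ (e-xY a)
  dominating (vZ b) = vx , here refl , inj₂ (e-xZ b)

  totalDominationNumber≡3 : 0 < n → TotalDominationNumberIs (Vtx (suc n)) _~_ 3
  totalDominationNumber≡3 0<n =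
    (vx ∷ vz ∷ vZ fzero ∷ [] , distinct , dominating , refl) ,
    λ S _ → 3≤length-totalDominating _~_ vx (commonNonNeighbour 0<n) S
    where
    distinct : Unique (vx ∷ vz ∷ vZ fzero ∷ [])
    distinct = ((λ ()) ∷ (λ ()) ∷ []) ∷ ((λ ()) ∷ []) ∷ [] ∷ []

lemma2p3 : (m : ℕ) → 3 ≤ m → TotalDominationNumberIs (Vtx m) (Adj m) 3
lemma2p3 (suc n) (s≤s 2≤n) = totalDominationNumber≡3 n (≤-trans (s≤s z≤n) 2≤n)
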